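{- Let $s\ge1$, $t\ge 2$, $G\in\mathcal{G}_{s,t}$ with root $r$, and let $C$ be a non-trivial configuration with exactly one pebble-free vertex in $S$. Then Mover has a winning strategy if and only if $C_T\ge 2$.
   Context: A configuration $C$ on a graph $G$ is a function $C:V(G)\to\mathbb{Z}_{\ge 0}$. A pebbling move removes two pebbles from a vertex and places one pebble on an adjacent vertex. The Two-Player Pebbling Game on $G$ with root $r$ and starting configuration $C$ is played by Mover and Defender in rounds: in each round Mover makes a pebbling move and then Defender makes a pebbling move; each player must take their turn. If Mover pebbles from $u$ to $v$, Defender may not pebble from $v$ to $u$ in the same round. Mover wins if at any time the root has at least one pebble; Defender wins if the root has no pebble and there are no more pebbling moves. A winning strategy is a rule choosing a player's moves as a function of the current position which guarantees that player wins. For integers $s,t\ge1$, $\mathcal{G}_{s,t}$ is the class of all graphs $(K_1\cup \overline{K_t})\vee H$, where $H$ is any graph on $s$ vertices, $\overline{K_t}$ is the edgeless graph on $t$ vertices, $\cup$ is disjoint union and $\vee$ is the join. The root $r$ is the vertex of $K_1$; $S=V(H)$, $T=V(\overline{K_t})$. A configuration is non-trivial if each vertex of $S$ has 0 or 1 pebbles and the root has no pebbles. A vertex is pebble-free if it has no pebbles. $C_T=\sum_{v\in T}\lfloor C(v)/2\rfloor$. -}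

module Defs where

open import Data.Nat using (ℕ; zero; suc; _≤_; _∸_; ⌊_/2⌋)
open import Data.Fin as Fin using (Fin)
open import Data.List using (List; map; allFin)
open import Data.Nat.ListAction using (sum)
open import Data.Product using (Σ; ∃; _×_; _,_)
open import Data.Unit using (⊤)
open import Data.Empty using (⊥)
open import Relation.Nullary using (¬_; yes; no)
open import Relation.Binary.PropositionalEquality using (_≡_)

record SimpleGraph (s : ℕ) : Set₁ where
  field
    E     : Fin s → Fin s → Set
    sym   : ∀ {i j} → E i j → E j i
    irrefl : ∀ {i} → ¬ E i i
open SimpleGraph public

-- Vertices of G = (K₁ ∪ \overline{K_t}) ∨ H : the root r, S = V(H), T.
data Vtx (s t : ℕ) : Set where
  root : Vtx s t
  sv   : Fin s → Vtx s t
  tv   : Fin t → Vtx s t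

Adj : ∀ {s t} → SimpleGraph s → Vtx s t → Vtx s t → Set
Adj H root   root   = ⊥
Adj H root   (sv _) = ⊤
Adj H root   (tv _) = ⊥
Adj H (sv _) root   = ⊤
Adj H (sv i) (sv j) = E H i j
Adj H (sv _) (tv _) = ⊤
Adj H (tv _) root   = ⊥
Adj H (tv _) (sv _) = ⊤
Adj H (tv _) (tv _) = ⊥

_≟V_ : ∀ {s t} → (x y : Vtx s t) → Relation.Nullary.Dec (x ≡ y)
root ≟V root = yes Relation.Binary.PropositionalEquality.refl
root ≟V sv _ = no (λ ())
root ≟V tv _ = no (λ ())
sv _ ≟V root = no (λ ())
sv i ≟V sv j with i Fin.≟ j
... | yes Relation.Binary.PropositionalEquality.refl = yes Relation.Binary.PropositionalEquality.refl
... | no i≢j = no (λ { Relation.Binary.PropositionalEquality.refl → i≢j Relation.Binary.PropositionalEquality.refl })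
sv _ ≟V tv _ = no (λ ())
tv _ ≟V root = no (λ ())
tv _ ≟V sv _ = no (λ ())
tv i ≟V tv j with i Fin.≟ j
... | yes Relation.Binary.PropositionalEquality.refl = yes Relation.Binary.PropositionalEquality.refl
... | no i≢j = no (λ { Relation.Binary.PropositionalEquality.refl → i≢j Relation.Binary.PropositionalEquality.refl })

Config : ℕ → ℕ → Set
Config s t = Vtx s t → ℕ

pebble : ∀ {s t} → Config s t → Vtx s t → Vtx s t → Config s t
pebble C u v x with x ≟V u
... | yes _ = C u ∸ 2
... | no _ with x ≟V v
...   | yes _ = suc (C v)
...   | no _  = C x

Move : ∀ {s t} → SimpleGraph s → Config s t → Vtx s t → Vtx s t → Set
Move H C u v = Adj H u v × 2 ≤ C u

-- Since each move
-- decreases the total number of pebbles, the game is finite and Mover has a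
-- winning strategy iff the following inductively defined predicates hold.
--   MoverWins H C      : Mover is to move in configuration C.
--   DefLoses H C u v   : Defender is to move in C, Mover's last move was u → v
--                        (so Defender may not pebble v → u).
-- The game ends (Defender wins, root being empty) when the player to move
-- has no legal move.
mutual
  data MoverWins {s t} (H : SimpleGraph s) (C : Config s t) : Set where
    m-root : 1 ≤ C root → MoverWins H C
    m-move : ∀ u v → Move H C u v → DefLoses H (pebble C u v) u v → MoverWins H C

  data DefLoses {s t} (H : SimpleGraph s) (C : Config s t) (u v : Vtx s t) : Set where
    d-root : 1 ≤ C root → DefLoses H C u v
    d-all  : (Σ (Vtx s t) λ x → Σ (Vtx s t) λ y → Move H C x y × ¬ (x ≡ v × y ≡ u))
           → (∀ x y → Move H C x y → ¬ (x ≡ v × y ≡ u) → MoverWins H (pebble C x y))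
           → DefLoses H C u v

NonTrivial : ∀ {s t} → Config s t → Set
NonTrivial {s} C = C root ≡ 0 × (∀ (i : Fin s) → C (sv i) ≤ 1)

ExactlyOneFreeInS : ∀ {s t} → Config s t → Set
ExactlyOneFreeInS {s} C = Σ (Fin s) λ i → C (sv i) ≡ 0 × (∀ j → C (sv j) ≡ 0 → j ≡ i)

C-T : ∀ {s t} → Config s t → ℕ
C-T {s} {t} C = sum (map (λ j → ⌊ C (tv j) /2⌋) (allFin t))

-- If C_T ≥ 2, some T-vertex a carries two pebbles and,
-- after spending them, a (possibly different) T-vertex b still carries two.
-- Mover plays a → w, filling S.  Defender can now only move from T to S,
-- which puts two pebbles on an S-vertex, and Mover pebbles it to the root.
--
-- Call C quiet if the root is empty, every S-vertex has
-- at most one pebble and C_T ≤ 1.  From a quiet position Mover can only play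
-- some a → y with a ∈ T, y ∈ S.  If y was empty, no pebbling move remains;
-- otherwise Defender answers y → b for some b ∈ T with b ≠ a, which restores
-- quietness.  By induction on the game tree Mover never wins from a quiet C.
module Submission where

open import Defs hiding (sym)
open import Data.Nat using (ℕ; zero; suc; _+_; _∸_; _≤_; z≤n; s≤s; ⌊_/2⌋; _≤?_)
open import Data.Nat.Properties
  using ( <-irrefl; ≤-refl; ≤-trans; ≤-reflexive; ≤-pred; ≰⇒>; m≤m+n; m≤n+m; +-comm; +-suc
        ; +-identityʳ; +-monoʳ-≤; +-monoˡ-≤; ∸-monoˡ-≤; n≤0⇒n≡0; n≤1⇒n≡0∨n≡1
        ; ⌊n/2⌋-mono; n≡⌊n+n/2⌋; module ≤-Reasoning)
open import Data.Fin as Fin using (Fin)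
open import Data.Fin.Properties using (suc-injective)
open import Data.List using (tabulate)
open import Data.List.Properties using (map-tabulate)
open import Data.Nat.ListAction using (sum)
open import Data.Product using (∃; ∃₂; _×_; _,_; proj₁; proj₂)
open import Data.Sum using (_⊎_; inj₁; inj₂)
open import Data.Unit using (tt)
open import Data.Empty using (⊥-elim)
open import Function using (_∘_)
open import Function.Bundles using (_⇔_; mk⇔)
open import Relation.Nullary using (¬_; yes; no)
open import Relation.Nullary.Decidable using (toSum)
open import Relation.Binary.PropositionalEquality
  using (_≡_; _≢_; refl; sym; trans; cong; cong₂; subst)

sumFin : ∀ {t} → (Fin t → ℕ) → ℕ
sumFin f = sum (tabulate f)

term≤sumFin : ∀ {t} (f : Fin t → ℕ) (a : Fin t) → f a ≤ sumFin f
term≤sumFin f Fin.zero    = m≤m+n (f Fin.zero) _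
term≤sumFin f (Fin.suc a) = ≤-trans (term≤sumFin (f ∘ Fin.suc) a) (m≤n+m _ (f Fin.zero))

pair≤sumFin : ∀ {t} (f : Fin t → ℕ) (a b : Fin t) → a ≢ b → f a + f b ≤ sumFin f
pair≤sumFin f Fin.zero    Fin.zero    a≢b = ⊥-elim (a≢b refl)
pair≤sumFin f Fin.zero    (Fin.suc b) _   = +-monoʳ-≤ (f Fin.zero) (term≤sumFin (f ∘ Fin.suc) b)
pair≤sumFin f (Fin.suc a) Fin.zero    _   = begin
  f (Fin.suc a) + f Fin.zero  ≡⟨ +-comm (f (Fin.suc a)) (f Fin.zero) ⟩
  f Fin.zero + f (Fin.suc a)  ≤⟨ +-monoʳ-≤ (f Fin.zero) (term≤sumFin (f ∘ Fin.suc) a) ⟩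
  sumFin f                    ∎
  where open ≤-Reasoning
pair≤sumFin f (Fin.suc a) (Fin.suc b) a≢b =
  ≤-trans (pair≤sumFin (f ∘ Fin.suc) a b (a≢b ∘ cong Fin.suc)) (m≤n+m _ (f Fin.zero))

sumFin-zero : ∀ {t} (f : Fin t → ℕ) → (∀ j → f j ≡ 0) → sumFin f ≡ 0
sumFin-zero {zero}  f vanish = refl
sumFin-zero {suc t} f vanish =
  cong₂ _+_ (vanish Fin.zero) (sumFin-zero (f ∘ Fin.suc) (vanish ∘ Fin.suc))

sumFin-supported : ∀ {t} (f : Fin t → ℕ) (a : Fin t)
                 → (∀ j → j ≢ a → f j ≡ 0) → sumFin f ≡ f a
sumFin-supported f Fin.zero vanish =
  trans (cong (f Fin.zero +_) (sumFin-zero (f ∘ Fin.suc) (λ j → vanish (Fin.suc j) (λ ()))))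
        (+-identityʳ (f Fin.zero))
sumFin-supported f (Fin.suc a) vanish =
  cong₂ _+_ (vanish Fin.zero (λ ()))
            (sumFin-supported (f ∘ Fin.suc) a (λ j j≢a → vanish (Fin.suc j) (j≢a ∘ suc-injective)))

sumFin-positive : ∀ {t} (f : Fin t → ℕ) → 1 ≤ sumFin f → ∃ λ a → 1 ≤ f a
sumFin-positive {suc t} f pos with f Fin.zero in eq
... | suc _ = Fin.zero , subst (1 ≤_) (sym eq) (s≤s z≤n)
... | zero with sumFin-positive (f ∘ Fin.suc) pos
...   | a , fa = Fin.suc a , fa

sumFin-atLeastTwo : ∀ {t} (f : Fin t → ℕ) → 2 ≤ sumFin f
                  → (∃ λ a → 2 ≤ f a) ⊎ (∃₂ λ a b → a ≢ b × 1 ≤ f a × 1 ≤ f b)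
sumFin-atLeastTwo {suc t} f two with f Fin.zero in eq
... | suc (suc _) = inj₁ (Fin.zero , subst (2 ≤_) (sym eq) (s≤s (s≤s z≤n)))
... | suc zero with sumFin-positive (f ∘ Fin.suc) (≤-pred two)
...   | b , fb = inj₂ (Fin.zero , Fin.suc b , (λ ()) , subst (1 ≤_) (sym eq) ≤-refl , fb)
sumFin-atLeastTwo {suc t} f two | zero with sumFin-atLeastTwo (f ∘ Fin.suc) two
... | inj₁ (a , fa)                = inj₁ (Fin.suc a , fa)
... | inj₂ (a , b , a≢b , fa , fb) = inj₂ (Fin.suc a , Fin.suc b , a≢b ∘ suc-injective , fa , fb)

half-lower : ∀ k n → k ≤ ⌊ n /2⌋ → k + k ≤ n
half-lower zero    n             _       = z≤n
half-lower (suc k) zero          ()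
half-lower (suc k) (suc zero)    ()
half-lower (suc k) (suc (suc n)) (s≤s p) rewrite +-suc k k = s≤s (s≤s (half-lower k n p))

half-lower-inv : ∀ k n → k + k ≤ n → k ≤ ⌊ n /2⌋
half-lower-inv k n p = ≤-trans (≤-reflexive (n≡⌊n+n/2⌋ k)) (⌊n/2⌋-mono p)

half-upper : ∀ k n → ⌊ n /2⌋ ≤ k → n ≤ suc (k + k)
half-upper k       zero          _       = z≤n
half-upper k       (suc zero)    _       = s≤s z≤n
half-upper zero    (suc (suc n)) ()
half-upper (suc k) (suc (suc n)) (s≤s p) rewrite +-suc k k = s≤s (s≤s (half-upper k n p))

half-upper-inv : ∀ k n → n ≤ suc (k + k) → ⌊ n /2⌋ ≤ k
half-upper-inv k       zero          _ = z≤n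
half-upper-inv k       (suc zero)    _ = z≤n
half-upper-inv zero    (suc (suc n)) (s≤s ())
half-upper-inv (suc k) (suc (suc n)) p rewrite +-suc k k =
  s≤s (half-upper-inv k n (≤-pred (≤-pred p)))

halfSum : ∀ {t} → (Fin t → ℕ) → ℕ
halfSum g = sumFin (λ j → ⌊ g j /2⌋)

C-T≡halfSum : ∀ {s t} (C : Config s t) → C-T C ≡ halfSum (λ j → C (tv j))
C-T≡halfSum C = cong sum (map-tabulate (λ j → j) (λ j → ⌊ C (tv j) /2⌋))

halfSum-atLeastTwo : ∀ {t} (g : Fin t → ℕ) → 2 ≤ halfSum g
                   → (∃ λ a → 4 ≤ g a) ⊎ (∃₂ λ a b → a ≢ b × 2 ≤ g a × 2 ≤ g b)
halfSum-atLeastTwo g two with sumFin-atLeastTwo (λ j → ⌊ g j /2⌋) two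
... | inj₁ (a , ga)                = inj₁ (a , half-lower 2 (g a) ga)
... | inj₂ (a , b , a≢b , ga , gb) = inj₂ (a , b , a≢b , half-lower 1 (g a) ga , half-lower 1 (g b) gb)

halfSum-atMostOne-at : ∀ {t} (g : Fin t → ℕ) (a : Fin t) → halfSum g ≤ 1 → 2 ≤ g a
                     → g a ≤ 3 × (∀ j → j ≢ a → g j ≤ 1)
halfSum-atMostOne-at g a small ga =
  half-upper 1 (g a) (≤-trans (term≤sumFin h a) small) , others
  where
  h : Fin _ → ℕ
  h j = ⌊ g j /2⌋
  others : ∀ j → j ≢ a → g j ≤ 1
  others j j≢a = half-upper 0 (g j) (≤-pred (begin
    1 + h j    ≤⟨ +-monoˡ-≤ (h j) (half-lower-inv 1 (g a) ga) ⟩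
    h a + h j  ≤⟨ pair≤sumFin h a j (j≢a ∘ sym) ⟩
    halfSum g  ≤⟨ small ⟩
    1          ∎))
    where open ≤-Reasoning

halfSum-atMostOne-of : ∀ {t} (g : Fin t → ℕ) (b : Fin t) → g b ≤ 3
                     → (∀ j → j ≢ b → g j ≤ 1) → halfSum g ≤ 1
halfSum-atMostOne-of g b gb others =
  subst (_≤ 1) (sym (sumFin-supported (λ j → ⌊ g j /2⌋) b vanish)) (half-upper-inv 1 (g b) gb)
  where
  vanish : ∀ j → j ≢ b → ⌊ g j /2⌋ ≡ 0
  vanish j j≢b = n≤0⇒n≡0 (half-upper-inv 0 (g j) (others j j≢b))

module _ {s t : ℕ} (C : Config s t) (u v : Vtx s t) where

  pebble-source : pebble C u v u ≡ C u ∸ 2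
  pebble-source with u ≟V u
  ... | yes _   = refl
  ... | no u≢u  = ⊥-elim (u≢u refl)

  pebble-target : v ≢ u → pebble C u v v ≡ suc (C v)
  pebble-target v≢u with v ≟V u
  ... | yes v≡u = ⊥-elim (v≢u v≡u)
  ... | no _ with v ≟V v
  ...   | yes _  = refl
  ...   | no v≢v = ⊥-elim (v≢v refl)

  pebble-other : ∀ x → x ≢ u → x ≢ v → pebble C u v x ≡ C x
  pebble-other x x≢u x≢v with x ≟V u
  ... | yes x≡u = ⊥-elim (x≢u x≡u)
  ... | no _ with x ≟V v
  ...   | yes x≡v = ⊥-elim (x≢v x≡v)
  ...   | no _    = refl

cannotPebbleFrom : ∀ {n} → n ≤ 1 → ¬ 2 ≤ n
cannotPebbleFrom n≤1 two = <-irrefl refl (≤-trans two n≤1)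

anotherIndex : ∀ {t} → 2 ≤ t → (a : Fin t) → ∃ λ b → b ≢ a
anotherIndex (s≤s (s≤s _)) Fin.zero    = Fin.suc Fin.zero , λ ()
anotherIndex (s≤s (s≤s _)) (Fin.suc a) = Fin.zero , λ ()

module Game {s t : ℕ} (H : SimpleGraph s) where

  finishFromS : ∀ (C : Config s t) i → 2 ≤ C (sv i) → MoverWins H C
  finishFromS C i two =
    m-move (sv i) root (tt , two)
      (d-root (subst (1 ≤_) (sym (pebble-target C (sv i) root (λ ()))) (s≤s z≤n)))

  -- Defender to move, after a Mover move out of T, with the root empty, every
  -- S-vertex holding exactly one pebble and some T-vertex b holding two:
  -- Defender's only moves go T → S (b → i is one), and then Mover finishes.
  defenderMustFeedS : ∀ (C : Config s t) (a : Fin t) v → C root ≡ 0 → (∀ i → C (sv i) ≡ 1)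
                    → Fin s → (∃ λ b → 2 ≤ C (tv b)) → DefLoses H C (tv a) v
  defenderMustFeedS C a v empty full i (b , reserve) =
    d-all (tv b , sv i , (tt , reserve) , λ { (_ , ()) }) reply
    where
    reply : ∀ x y → Move H C x y → ¬ (x ≡ v × y ≡ tv a) → MoverWins H (pebble C x y)
    reply root    _        (_ , two) _ = ⊥-elim (cannotPebbleFrom (≤-trans (≤-reflexive empty) z≤n) two)
    reply (sv j)  _        (_ , two) _ = ⊥-elim (cannotPebbleFrom (≤-reflexive (full j)) two)
    reply (tv b′) (sv j)   _         _ =
      finishFromS _ j (≤-reflexive (sym (trans (pebble-target C (tv b′) (sv j) (λ ()))
                                               (cong suc (full j)))))

  fillTheHole : ∀ (C : Config s t) → NonTrivial C → ((w , _) : ExactlyOneFreeInS C)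
              → ∀ a → 2 ≤ C (tv a) → (∃ λ b → 2 ≤ pebble C (tv a) (sv w) (tv b)) → MoverWins H C
  fillTheHole C (rootEmpty , sLow) (w , wEmpty , onlyW) a twoAtA reserve =
    m-move (tv a) (sv w) (tt , twoAtA) (defenderMustFeedS C₁ a (sv w) emptyRoot fullS w reserve)
    where
    C₁ : Config s t
    C₁ = pebble C (tv a) (sv w)
    emptyRoot : C₁ root ≡ 0
    emptyRoot = trans (pebble-other C (tv a) (sv w) root (λ ()) (λ ())) rootEmpty
    fullS : ∀ i → C₁ (sv i) ≡ 1
    fullS i with toSum (i Fin.≟ w)
    ... | inj₁ refl = trans (pebble-target C (tv a) (sv w) (λ ())) (cong suc wEmpty)
    ... | inj₂ i≢w with n≤1⇒n≡0∨n≡1 (sLow i)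
    ...   | inj₁ empty = ⊥-elim (i≢w (onlyW i empty))
    ...   | inj₂ one   = trans (pebble-other C (tv a) (sv w) (sv i) (λ ()) (λ { refl → i≢w refl })) one

  -- The winning direction.  Since C_T ≥ 2, either a T-vertex with four pebbles
  -- serves as both source and reserve, or two distinct T-vertices with two
  -- pebbles each do.
  moverWins : (C : Config s t) → NonTrivial C → ExactlyOneFreeInS C → 2 ≤ C-T C → MoverWins H C
  moverWins C nonTrivial oneFree@(w , _) two
    with halfSum-atLeastTwo (λ j → C (tv j)) (subst (2 ≤_) (C-T≡halfSum C) two)
  ... | inj₁ (a , four) =
    fillTheHole C nonTrivial oneFree a (≤-trans (s≤s (s≤s z≤n)) four)
      (a , subst (2 ≤_) (sym (pebble-source C (tv a) (sv w))) (∸-monoˡ-≤ 2 four))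
  ... | inj₂ (a , b , a≢b , twoAtA , twoAtB) =
    fillTheHole C nonTrivial oneFree a twoAtA
      (b , subst (2 ≤_) (sym (pebble-other C (tv a) (sv w) (tv b) (λ { refl → a≢b refl }) (λ ()))) twoAtB)

  Quiet : Config s t → Set
  Quiet C = C root ≡ 0 × (∀ i → C (sv i) ≤ 1) × C-T C ≤ 1

  quietMoves : ∀ (C : Config s t) → C root ≡ 0 → (∀ i → C (sv i) ≤ 1)
             → ∀ u v → Move H C u v → ∃₂ λ a y → u ≡ tv a × v ≡ sv y
  quietMoves C empty _    root   _      (_ , two) =
    ⊥-elim (cannotPebbleFrom (≤-trans (≤-reflexive empty) z≤n) two)
  quietMoves C _     sLow (sv i) _      (_ , two) = ⊥-elim (cannotPebbleFrom (sLow i) two)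
  quietMoves C _     _    (tv a) (sv y) _         = a , y , refl , refl

  drainedT : ∀ (C : Config s t) a y → C-T C ≤ 1 → 2 ≤ C (tv a)
           → ∀ j → pebble C (tv a) (sv y) (tv j) ≤ 1
  drainedT C a y small twoAtA j
    with halfSum-atMostOne-at (λ k → C (tv k)) a (subst (_≤ 1) (C-T≡halfSum C) small) twoAtA
       | toSum (j Fin.≟ a)
  ... | atMost3 , _ | inj₁ refl =
    subst (_≤ 1) (sym (pebble-source C (tv a) (sv y))) (∸-monoˡ-≤ 2 atMost3)
  ... | _ , others  | inj₂ j≢a   =
    subst (_≤ 1) (sym (pebble-other C (tv a) (sv y) (tv j) (λ { refl → j≢a refl }) (λ ())))
          (others j j≢a)

  stalled : ∀ (C : Config s t) a y → Quiet C → 2 ≤ C (tv a) → C (sv y) ≡ 0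
          → ∀ x → pebble C (tv a) (sv y) x ≤ 1
  stalled C a y (empty , _ , _) _ _ root =
    ≤-trans (≤-reflexive (trans (pebble-other C (tv a) (sv y) root (λ ()) (λ ())) empty)) z≤n
  stalled C a y (_ , sLow , _) _ yEmpty (sv i) with toSum (i Fin.≟ y)
  ... | inj₁ refl = ≤-reflexive (trans (pebble-target C (tv a) (sv y) (λ ())) (cong suc yEmpty))
  ... | inj₂ i≢y   =
    ≤-trans (≤-reflexive (pebble-other C (tv a) (sv y) (sv i) (λ ()) (λ { refl → i≢y refl }))) (sLow i)
  stalled C a y (_ , _ , small) twoAtA _ (tv j) = drainedT C a y small twoAtA j

  -- If Mover moved a → y onto a full y, Defender's answer y → b (b ≠ a)
  -- empties y again and leaves at most 2 pebbles on b: the position is quiet.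
  restoresQuiet : ∀ (C : Config s t) a y b → Quiet C → 2 ≤ C (tv a) → C (sv y) ≡ 1 → b ≢ a
                → Quiet (pebble (pebble C (tv a) (sv y)) (sv y) (tv b))
  restoresQuiet C a y b (empty , sLow , small) twoAtA yFull b≢a =
    emptyRoot , lowS , subst (_≤ 1) (sym (C-T≡halfSum C₂)) (halfSum-atMostOne-of _ b lowB lowT)
    where
    C₁ C₂ : Config s t
    C₁ = pebble C (tv a) (sv y)
    C₂ = pebble C₁ (sv y) (tv b)
    twoAtY : C₁ (sv y) ≡ 2
    twoAtY = trans (pebble-target C (tv a) (sv y) (λ ())) (cong suc yFull)
    emptyRoot : C₂ root ≡ 0
    emptyRoot = trans (pebble-other C₁ (sv y) (tv b) root (λ ()) (λ ()))
                      (trans (pebble-other C (tv a) (sv y) root (λ ()) (λ ())) empty)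
    lowS : ∀ i → C₂ (sv i) ≤ 1
    lowS i with toSum (i Fin.≟ y)
    ... | inj₁ refl = ≤-trans (≤-reflexive (trans (pebble-source C₁ (sv y) (tv b)) (cong (_∸ 2) twoAtY)))
                             z≤n
    ... | inj₂ i≢y   = ≤-trans (≤-reflexive (trans
                       (pebble-other C₁ (sv y) (tv b) (sv i) (λ { refl → i≢y refl }) (λ ()))
                       (pebble-other C (tv a) (sv y) (sv i) (λ ()) (λ { refl → i≢y refl }))))
                     (sLow i)
    drained : ∀ j → C₁ (tv j) ≤ 1
    drained = drainedT C a y small twoAtA
    lowB : C₂ (tv b) ≤ 3
    lowB = ≤-trans (≤-reflexive (pebble-target C₁ (sv y) (tv b) (λ ()))) (s≤s (≤-trans (drained b) (s≤s z≤n)))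
    lowT : ∀ j → j ≢ b → C₂ (tv j) ≤ 1
    lowT j j≢b = ≤-trans (≤-reflexive (pebble-other C₁ (sv y) (tv b) (tv j) (λ ()) (λ { refl → j≢b refl })))
                         (drained j)

  quietLoses : 2 ≤ t → ∀ (C : Config s t) → Quiet C → ¬ MoverWins H C
  quietLoses t≥2 C (empty , _ , _) (m-root occupied) = <-irrefl refl (≤-trans occupied (≤-reflexive empty))
  quietLoses t≥2 C quiet@(empty , sLow , _) (m-move u v move answer)
    with quietMoves C empty sLow u v move
  ... | a , y , refl , refl = defenderHolds answer
    where
    twoAtA : 2 ≤ C (tv a)
    twoAtA = proj₂ move
    C₁ : Config s t
    C₁ = pebble C (tv a) (sv y)
    defenderHolds : ¬ DefLoses H C₁ (tv a) (sv y)
    defenderHolds (d-root occupied) =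
      <-irrefl refl (≤-trans occupied (≤-reflexive (trans (pebble-other C (tv a) (sv y) root (λ ()) (λ ())) empty)))
    defenderHolds (d-all (x , _ , (_ , two) , _) reply) with n≤1⇒n≡0∨n≡1 (sLow y)
    ... | inj₁ yEmpty = cannotPebbleFrom (stalled C a y quiet twoAtA yEmpty x) two
    ... | inj₂ yFull  with anotherIndex t≥2 a
    ...   | b , b≢a   =
      quietLoses t≥2 _ (restoresQuiet C a y b quiet twoAtA yFull b≢a)
        (reply (sv y) (tv b) (tt , ≤-reflexive (sym (trans (pebble-target C (tv a) (sv y) (λ ())) (cong suc yFull))))
               (λ { (_ , refl) → b≢a refl }))

lemma3p3 : ∀ (s t : ℕ) → 1 ≤ s → 2 ≤ t → (H : SimpleGraph s) → (C : Config s t)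
           → NonTrivial C → ExactlyOneFreeInS C
           → MoverWins H C ⇔ (2 ≤ C-T C)
lemma3p3 s t _ t≥2 H C nonTrivial oneFree = mk⇔ onlyIfWins (moverWins C nonTrivial oneFree)
  where
  open Game H
  onlyIfWins : MoverWins H C → 2 ≤ C-T C
  onlyIfWins wins with 2 ≤? C-T C
  ... | yes two = two
  ... | no ¬two = ⊥-elim (quietLoses t≥2 C (proj₁ nonTrivial , proj₂ nonTrivial , ≤-pred (≰⇒> ¬two)) wins)
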